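{- Let $X$ be a finite set with $n=|X|$, let $r\ge 2$, and let $\tau$ be a non-empty subset of $\binom{X}{r}$ with $L(\tau)=X$. If $\tau$ is thin, then: (i) $|\tau|\le n-r+1$; (ii) there is some $x\in X$ with $n_\tau(x)\le r-1$; (iii) for any subset $B$ of $X$ of size $r-1$, the collection of sets $\{S-B: S\in\tau\}$ has a system of distinct representatives.
   Context: $L(\tau)=\bigcup_{s\in\tau}s$. The excess of $\tau$ is ${\rm exc}(\tau)=|L(\tau)|-|\tau|-(r-1)$, and $\tau$ is thin if ${\rm exc}(\tau')\ge 0$ for every non-empty $\tau'\subseteq\tau$. For $x\in X$, $n_\tau(x)$ is the number of elements of $\tau$ containing $x$. A collection of (not necessarily distinct) sets $B_1,\dots,B_m$ has a system of distinct representatives if one can choose $x_i\in B_i$ for each $i$ with $x_1,\dots,x_m$ pairwise distinct. -}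

module Defs where

open import Data.Nat using (ℕ; _∸_)
open import Data.Integer using (ℤ; +_; _-_)
open import Data.Fin using (Fin)
open import Data.Fin.Subset using (Subset; ⋃; ∣_∣; _∈_)
open import Data.Fin.Subset.Properties using (_∈?_)
open import Data.List using (List; filter; map; length; allFin)

-- A collection τ = {S_1,...,S_m} of subsets of X = Fin n is given as an
-- indexed family  τ : Fin m → Subset n ; a sub-collection τ' ⊆ τ is given
-- by its index set  I : Subset m.

members : {m : ℕ} → Subset m → List (Fin m)
members I = filter (_∈? I) (allFin _)

L : {m n : ℕ} → (Fin m → Subset n) → Subset m → Subset n
L τ I = ⋃ (map τ (members I))

exc : {m n : ℕ} → ℕ → (Fin m → Subset n) → Subset m → ℤ
exc r τ I = (+ ∣ L τ I ∣ - + ∣ I ∣) - + (r ∸ 1)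

nτ : {m n : ℕ} → (Fin m → Subset n) → Fin n → ℕ
nτ {m} τ x = length (filter (λ i → x ∈? τ i) (allFin m))

-- (i) is thinness of τ itself: n = |L(τ)| ≥ |τ| + r − 1.  (ii) is double counting: the degrees
-- n_τ(x) sum to r|τ| < rn.  For (iii), thinness gives |L(τ′)| ≥ |τ′| + |B| for every non-empty
-- τ′ ⊆ τ, which is Hall's condition for the sets S − B.  Hall's theorem is proved by the
-- Halmos–Vaughan argument: while some set contains two points x ≠ y, deleting x or deleting y from it
-- preserves Hall's condition, because a deficient index set for each deletion would contradict the
-- submodularity of I ↦ |L(I)|; so one may shrink until all sets are singletons.
module Submission where

open import Defs
open import Data.Nat using (ℕ; _≤_; _∸_)
open import Data.Integer using (+_; _-_; _+_) renaming (_≤_ to _≤ℤ_)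
open import Data.Fin using (Fin)
open import Data.Fin.Subset using (Subset; ⊤; ∣_∣; _∈_; _─_; Nonempty)
open import Data.Product using (_×_; ∃; Σ)
open import Relation.Binary.PropositionalEquality using (_≡_)
open import Function.Definitions using (Injective)

open import Data.Nat as ℕ using (zero; suc; _<_; _*_; z≤n; s≤s; _≤?_)
open import Data.Nat.Properties
  using ( ≤-refl; ≤-trans; ≤-pred; <-≤-trans; <-irrefl; <⇒≱; ≰⇒>; ≮⇒≥; n<1+n; m<m+n
        ; +-suc; +-mono-≤; +-mono-<-≤; +-mono-≤-<; +-cancelʳ-≤; *-cancelʳ-≤; *-monoʳ-≤; ∸-monoˡ-≤
        ; m≤n+m∸n; m≤m+n; m+n≤o⇒n≤o; m+n≤o⇒m≤o∸n
        ; +-0-commutativeMonoid; module ≤-Reasoning )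
open import Data.Integer using (+≤+)
open import Data.Integer.Properties using (drop‿+≤+; 0≤i-j⇒j≤i; m-n≡m⊖n; ⊖-≥)
import Data.Integer.Tactic.RingSolver as ℤ-Ring
open import Algebra.Properties.CommutativeMonoid.Sum +-0-commutativeMonoid
  using (sum-syntax; ∑-comm; sum-cong-≗)
open import Data.Bool using (if_then_else_)
open import Data.Fin using (zero; suc; _≟_)
open import Data.Fin.Properties using (any?)
open import Data.Fin.Subset using (⁅_⁆; _∪_; _∩_; ⋃; _⊆_; _∉_; inside; outside)
open import Data.Fin.Subset.Properties
open import Data.List using (List; []; _∷_; map; filter; length; tabulate; allFin)
open import Data.List.Membership.Propositional using () renaming (_∈_ to _∈ₗ_)
open import Data.List.Membership.Propositional.Properties
  using (∈-map⁺; ∈-map⁻; ∈-filter⁺; ∈-filter⁻; ∈-allFin)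
open import Data.List.Relation.Unary.Any as Any using ()
open import Data.Product using (_,_; proj₁; proj₂; ∃₂)
open import Data.Sum using (_⊎_; inj₁; inj₂)
open import Data.Vec using ([]; _∷_; here; there)
open import Function using (id; _∘_; case_of_)
open import Relation.Nullary using (Dec; yes; no; does; contradiction)
open import Relation.Unary using (Pred; Decidable)
open import Relation.Binary.PropositionalEquality
  using (_≢_; refl; sym; trans; cong; subst; subst₂; module ≡-Reasoning)

private
  variable
    m n : ℕ
    p : Subset n
    x y : Fin n

∣p∣≡1+∣p─x∣ : x ∈ p → ∣ p ∣ ≡ suc ∣ p ─ ⁅ x ⁆ ∣
∣p∣≡1+∣p─x∣ {p = inside ∷ p} here = cong (λ s → suc ∣ s ∣) (sym (p─⊥≡p p))
∣p∣≡1+∣p─x∣ {p = inside ∷ p} (there x∈p) = cong suc (∣p∣≡1+∣p─x∣ x∈p)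
∣p∣≡1+∣p─x∣ {p = outside ∷ p} (there x∈p) = ∣p∣≡1+∣p─x∣ x∈p

x∈p⇒0<∣p∣ : x ∈ p → 0 < ∣ p ∣
x∈p⇒0<∣p∣ x∈p = subst (0 <_) (sym (∣p∣≡1+∣p─x∣ x∈p)) (s≤s z≤n)

0<∣p∣⇒Nonempty : ∀ (p : Subset n) → 0 < ∣ p ∣ → Nonempty p
0<∣p∣⇒Nonempty (inside ∷ p) _ = zero , here
0<∣p∣⇒Nonempty (outside ∷ p) 0<∣p∣ =
  let x , x∈p = 0<∣p∣⇒Nonempty p 0<∣p∣ in suc x , there x∈p

x∈p─q⇒x∉q : ∀ (p q : Subset n) → x ∈ p ─ q → x ∉ q
x∈p─q⇒x∉q (inside ∷ p) (outside ∷ q) here ()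
x∈p─q⇒x∉q (_ ∷ p) (_ ∷ q) (there x∈p─q) (there x∈q) = x∈p─q⇒x∉q p q x∈p─q x∈q

x∈p─⁅y⁆⇒x≢y : x ∈ p ─ ⁅ y ⁆ → x ≢ y
x∈p─⁅y⁆⇒x≢y {p = p} {y = y} x∈p─y refl = x∈p─q⇒x∉q p ⁅ y ⁆ x∈p─y (x∈⁅x⁆ y)

x≢y⇒2≤∣p∣ : x ∈ p → y ∈ p → x ≢ y → 2 ≤ ∣ p ∣
x≢y⇒2≤∣p∣ x∈p y∈p x≢y = subst (2 ≤_) (sym (∣p∣≡1+∣p─x∣ x∈p))
  (s≤s (x∈p⇒0<∣p∣ (x∈p∧x≢y⇒x∈p-y y∈p (x≢y ∘ sym))))

∣p∣≤1⇒x≡y : ∣ p ∣ ≤ 1 → x ∈ p → y ∈ p → x ≡ y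
∣p∣≤1⇒x≡y {x = x} {y = y} ∣p∣≤1 x∈p y∈p with x ≟ y
... | yes x≡y = x≡y
... | no x≢y = contradiction (≤-trans (x≢y⇒2≤∣p∣ x∈p y∈p x≢y) ∣p∣≤1) λ { (s≤s ()) }

2≤∣p∣⇒distinct : ∀ (p : Subset n) → 2 ≤ ∣ p ∣ → ∃₂ λ x y → x ∈ p × y ∈ p × x ≢ y
2≤∣p∣⇒distinct p 2≤∣p∣ =
  let x , x∈p = 0<∣p∣⇒Nonempty p (≤-trans (s≤s z≤n) 2≤∣p∣)
      y , y∈p─x = 0<∣p∣⇒Nonempty (p ─ ⁅ x ⁆) (≤-pred (subst (2 ≤_) (∣p∣≡1+∣p─x∣ x∈p) 2≤∣p∣))
  in x , y , x∈p , p─q⊆p p ⁅ x ⁆ y∈p─x , λ x≡y → x∈p─⁅y⁆⇒x≢y y∈p─x (sym x≡y)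

∣p∪q∣+∣p∩q∣≡∣p∣+∣q∣ : ∀ (p q : Subset n) → ∣ p ∪ q ∣ ℕ.+ ∣ p ∩ q ∣ ≡ ∣ p ∣ ℕ.+ ∣ q ∣
∣p∪q∣+∣p∩q∣≡∣p∣+∣q∣ [] [] = refl
∣p∪q∣+∣p∩q∣≡∣p∣+∣q∣ (inside ∷ p) (inside ∷ q)
  rewrite +-suc ∣ p ∪ q ∣ ∣ p ∩ q ∣ | +-suc ∣ p ∣ ∣ q ∣ = cong (2 ℕ.+_) (∣p∪q∣+∣p∩q∣≡∣p∣+∣q∣ p q)
∣p∪q∣+∣p∩q∣≡∣p∣+∣q∣ (inside ∷ p) (outside ∷ q) = cong suc (∣p∪q∣+∣p∩q∣≡∣p∣+∣q∣ p q)
∣p∪q∣+∣p∩q∣≡∣p∣+∣q∣ (outside ∷ p) (inside ∷ q)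
  rewrite +-suc ∣ p ∣ ∣ q ∣ = cong suc (∣p∪q∣+∣p∩q∣≡∣p∣+∣q∣ p q)
∣p∪q∣+∣p∩q∣≡∣p∣+∣q∣ (outside ∷ p) (outside ∷ q) = ∣p∪q∣+∣p∩q∣≡∣p∣+∣q∣ p q

∣p∪q∣≤∣p∣+∣q∣ : ∀ (p q : Subset n) → ∣ p ∪ q ∣ ≤ ∣ p ∣ ℕ.+ ∣ q ∣
∣p∪q∣≤∣p∣+∣q∣ p q = subst (∣ p ∪ q ∣ ≤_) (∣p∪q∣+∣p∩q∣≡∣p∣+∣q∣ p q) (m≤m+n _ _)

indicator : ∀ {a} {P : Set a} → Dec P → ℕ
indicator P? = if does P? then 1 else 0

∣p∣≡∑ : ∀ (p : Subset n) → ∣ p ∣ ≡ ∑[ x < n ] indicator (x ∈? p)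
∣p∣≡∑ [] = refl
∣p∣≡∑ (inside ∷ p) = cong suc (∣p∣≡∑ p)
∣p∣≡∑ (outside ∷ p) = ∣p∣≡∑ p

∑-mono-≤ : ∀ {f g : Fin m → ℕ} → (∀ i → f i ≤ g i) → ∑[ i < m ] f i ≤ ∑[ i < m ] g i
∑-mono-≤ {zero} f≤g = z≤n
∑-mono-≤ {suc m} f≤g = +-mono-≤ (f≤g zero) (∑-mono-≤ (f≤g ∘ suc))

∑-mono-< : ∀ {f g : Fin m → ℕ} → (∀ i → f i ≤ g i) → ∀ i → f i < g i →
           ∑[ i < m ] f i < ∑[ i < m ] g i
∑-mono-< f≤g zero fi<gi = +-mono-<-≤ fi<gi (∑-mono-≤ (f≤g ∘ suc))
∑-mono-< f≤g (suc i) fi<gi = +-mono-≤-< (f≤g zero) (∑-mono-< (f≤g ∘ suc) i fi<gi)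

∑-const : ∀ m c → ∑[ i < m ] c ≡ m * c
∑-const zero c = refl
∑-const (suc m) c = cong (c ℕ.+_) (∑-const m c)

x∈⋃⁺ : ∀ {S} {Ss : List (Subset n)} → S ∈ₗ Ss → x ∈ S → x ∈ ⋃ Ss
x∈⋃⁺ (Any.here refl) x∈S = x∈p∪q⁺ (inj₁ x∈S)
x∈⋃⁺ (Any.there S∈Ss) x∈S = x∈p∪q⁺ (inj₂ (x∈⋃⁺ S∈Ss x∈S))

x∈⋃⁻ : ∀ (Ss : List (Subset n)) → x ∈ ⋃ Ss → ∃ λ S → S ∈ₗ Ss × x ∈ S
x∈⋃⁻ [] x∈⊥ = contradiction x∈⊥ ∉⊥
x∈⋃⁻ (S ∷ Ss) x∈⋃ with x∈p∪q⁻ S (⋃ Ss) x∈⋃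
... | inj₁ x∈S = S , Any.here refl , x∈S
... | inj₂ x∈⋃Ss = let T , T∈Ss , x∈T = x∈⋃⁻ Ss x∈⋃Ss in T , Any.there T∈Ss , x∈T

module _ (A : Fin m → Subset n) where

  x∈L⁺ : ∀ {I j} → j ∈ I → x ∈ A j → x ∈ L A I
  x∈L⁺ {I = I} {j} j∈I = x∈⋃⁺ (∈-map⁺ A (∈-filter⁺ (_∈? I) (∈-allFin j) j∈I))

  x∈L⁻ : ∀ I → x ∈ L A I → ∃ λ j → j ∈ I × x ∈ A j
  x∈L⁻ I x∈L with x∈⋃⁻ (map A (members I)) x∈L
  ... | S , S∈ , x∈S with ∈-map⁻ A S∈
  ... | j , j∈members , refl = j , proj₂ (∈-filter⁻ (_∈? I) {xs = allFin m} j∈members) , x∈S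

  L-least : ∀ {I} {T : Subset n} → (∀ {j} → j ∈ I → A j ⊆ T) → L A I ⊆ T
  L-least {I} h x∈L = let j , j∈I , x∈Aj = x∈L⁻ I x∈L in h j∈I x∈Aj

HallCondition : (Fin m → Subset n) → Set
HallCondition {m} A = ∀ (I : Subset m) → ∣ I ∣ ≤ ∣ L A I ∣

Deficient : (Fin m → Subset n) → Subset m → Set
Deficient A I = ∣ L A I ∣ < ∣ I ∣

HallCondition⊎Deficient : ∀ (A : Fin m → Subset n) → HallCondition A ⊎ ∃ (Deficient A)
HallCondition⊎Deficient A with anySubset? (λ I → ∣ L A I ∣ ℕ.<? ∣ I ∣)
... | yes deficient = inj₂ deficient
... | no ¬deficient = inj₁ λ I → ≮⇒≥ (¬deficient ∘ (I ,_))

SDR : (Fin m → Subset n) → Set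
SDR {m} {n} A = Σ (Fin m → Fin n) λ f → Injective _≡_ _≡_ f × (∀ i → f i ∈ A i)

SDR-mono : ∀ {A B : Fin m → Subset n} → (∀ i → B i ⊆ A i) → SDR B → SDR A
SDR-mono B⊆A (f , f-injective , f∈B) = f , f-injective , λ i → B⊆A i (f∈B i)

module _ {A : Fin m → Subset n} (hall : HallCondition A) where
  open ≤-Reasoning

  private
    nonempty : ∀ i → Nonempty (A i)
    nonempty i = 0<∣p∣⇒Nonempty (A i) (begin
      1             ≡⟨ sym (∣⁅x⁆∣≡1 i) ⟩
      ∣ ⁅ i ⁆ ∣     ≤⟨ hall ⁅ i ⁆ ⟩
      ∣ L A ⁅ i ⁆ ∣ ≤⟨ p⊆q⇒∣p∣≤∣q∣ (L-least A λ j∈⁅i⁆ → subst (λ j → _ ∈ A j) (x∈⁅y⁆⇒x≡y i j∈⁅i⁆)) ⟩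
      ∣ A i ∣       ∎)

  Hall⇒SDR-small : (∀ i → ∣ A i ∣ ≤ 1) → SDR A
  Hall⇒SDR-small small = f , f-injective , f∈A
    where
    f : Fin m → Fin n
    f i = proj₁ (nonempty i)

    f∈A : ∀ i → f i ∈ A i
    f∈A i = proj₂ (nonempty i)

    A⊆⁅f⁆ : ∀ i → A i ⊆ ⁅ f i ⁆
    A⊆⁅f⁆ i x∈Ai = subst (_∈ ⁅ f i ⁆) (sym (∣p∣≤1⇒x≡y (small i) x∈Ai (f∈A i))) (x∈⁅x⁆ (f i))

    f-injective : Injective _≡_ _≡_ f
    f-injective {j} {k} fj≡fk with j ≟ k
    ... | yes j≡k = j≡k
    ... | no j≢k = contradiction (begin
      2                           ≤⟨ x≢y⇒2≤∣p∣ (x∈p∪q⁺ (inj₁ (x∈⁅x⁆ j))) (x∈p∪q⁺ (inj₂ (x∈⁅x⁆ k))) j≢k ⟩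
      ∣ ⁅ j ⁆ ∪ ⁅ k ⁆ ∣           ≤⟨ hall _ ⟩
      ∣ L A (⁅ j ⁆ ∪ ⁅ k ⁆) ∣     ≤⟨ p⊆q⇒∣p∣≤∣q∣ (L-least A pair⊆) ⟩
      ∣ ⁅ f j ⁆ ∣                 ≡⟨ ∣⁅x⁆∣≡1 (f j) ⟩
      1                           ∎) λ { (s≤s ()) }
      where
      pair⊆ : ∀ {l} → l ∈ ⁅ j ⁆ ∪ ⁅ k ⁆ → A l ⊆ ⁅ f j ⁆
      pair⊆ l∈ with x∈p∪q⁻ ⁅ j ⁆ ⁅ k ⁆ l∈
      ... | inj₁ l∈⁅j⁆ with refl ← x∈⁅y⁆⇒x≡y j l∈⁅j⁆ = A⊆⁅f⁆ j
      ... | inj₂ l∈⁅k⁆ with refl ← x∈⁅y⁆⇒x≡y k l∈⁅k⁆ = subst (λ z → A k ⊆ ⁅ z ⁆) (sym fj≡fk) (A⊆⁅f⁆ k)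

shrink : (Fin m → Subset n) → Fin m → Fin n → Fin m → Subset n
shrink A i x j with j ≟ i
... | yes _ = A j ─ ⁅ x ⁆
... | no _ = A j

module _ (A : Fin m → Subset n) (i : Fin m) (x : Fin n) where

  shrink-⊆ : ∀ j → shrink A i x j ⊆ A j
  shrink-⊆ j with j ≟ i
  ... | yes _ = p─q⊆p (A j) ⁅ x ⁆
  ... | no _ = id

  ∈-shrink-≢ : ∀ {j z} → j ≢ i → z ∈ A j → z ∈ shrink A i x j
  ∈-shrink-≢ {j} j≢i z∈Aj with j ≟ i
  ... | yes j≡i = contradiction j≡i j≢i
  ... | no _ = z∈Aj

  ∈-shrink-≡ : ∀ {z} → z ∈ A i → z ≢ x → z ∈ shrink A i x i
  ∈-shrink-≡ z∈Ai z≢x with i ≟ i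
  ... | yes _ = x∈p∧x≢y⇒x∈p-y z∈Ai z≢x
  ... | no i≢i = contradiction refl i≢i

  ∣shrink∣<∣A∣ : x ∈ A i → ∣ shrink A i x i ∣ < ∣ A i ∣
  ∣shrink∣<∣A∣ x∈Ai with i ≟ i
  ... | yes _ = x∈p⇒∣p-x∣<∣p∣ x∈Ai
  ... | no i≢i = contradiction refl i≢i

module _ {A : Fin m → Subset n} (hall : HallCondition A) {i : Fin m} where
  open ≤-Reasoning

  Hall-shrink-∉ : ∀ x {I} → i ∉ I → ∣ I ∣ ≤ ∣ L (shrink A i x) I ∣
  Hall-shrink-∉ x {I} i∉I = ≤-trans (hall I) (p⊆q⇒∣p∣≤∣q∣ (L-least A λ j∈I →
    x∈L⁺ (shrink A i x) j∈I ∘ ∈-shrink-≢ A i x λ { refl → i∉I j∈I }))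

  -- A point of A i missing from U is x, which lies in V as x ≢ y; the index i, dropped from
  -- I₁ ∩ I₂ to keep both families unshrunk there, accounts for the 1.
  shrink-submodular : ∀ {x y I₁ I₂} → x ≢ y → i ∈ I₁ → i ∈ I₂ →
    ∣ I₁ ∣ ℕ.+ ∣ I₂ ∣ ≤ suc (∣ L (shrink A i x) I₁ ∣ ℕ.+ ∣ L (shrink A i y) I₂ ∣)
  shrink-submodular {x} {y} {I₁} {I₂} x≢y i∈I₁ i∈I₂ = begin
    ∣ I₁ ∣ ℕ.+ ∣ I₂ ∣               ≡⟨ sym (∣p∪q∣+∣p∩q∣≡∣p∣+∣q∣ I₁ I₂) ⟩
    ∣ I₁ ∪ I₂ ∣ ℕ.+ ∣ I₁ ∩ I₂ ∣     ≡⟨ cong (∣ I₁ ∪ I₂ ∣ ℕ.+_) (∣p∣≡1+∣p─x∣ (x∈p∩q⁺ (i∈I₁ , i∈I₂))) ⟩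
    ∣ I₁ ∪ I₂ ∣ ℕ.+ suc ∣ J ∣       ≡⟨ +-suc ∣ I₁ ∪ I₂ ∣ ∣ J ∣ ⟩
    suc (∣ I₁ ∪ I₂ ∣ ℕ.+ ∣ J ∣)     ≤⟨ s≤s (+-mono-≤ (≤-trans (hall _) (p⊆q⇒∣p∣≤∣q∣ L∪⊆U∪V))
                                                   (≤-trans (hall J) (p⊆q⇒∣p∣≤∣q∣ LJ⊆U∩V))) ⟩
    suc (∣ U ∪ V ∣ ℕ.+ ∣ U ∩ V ∣)   ≡⟨ cong suc (∣p∪q∣+∣p∩q∣≡∣p∣+∣q∣ U V) ⟩
    suc (∣ U ∣ ℕ.+ ∣ V ∣)           ∎
    where
    U = L (shrink A i x) I₁
    V = L (shrink A i y) I₂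
    J = I₁ ∩ I₂ ─ ⁅ i ⁆

    L∪⊆U∪V : L A (I₁ ∪ I₂) ⊆ U ∪ V
    L∪⊆U∪V = L-least A A⊆U∪V
      where
      A⊆U∪V : ∀ {j} → j ∈ I₁ ∪ I₂ → A j ⊆ U ∪ V
      A⊆U∪V {j} j∈I₁∪I₂ {z} z∈Aj with j ≟ i | z ≟ x | x∈p∪q⁻ I₁ I₂ j∈I₁∪I₂
      ... | yes refl | yes refl | _ = x∈p∪q⁺ (inj₂ (x∈L⁺ _ i∈I₂ (∈-shrink-≡ A i y z∈Aj x≢y)))
      ... | yes refl | no z≢x | _ = x∈p∪q⁺ (inj₁ (x∈L⁺ _ i∈I₁ (∈-shrink-≡ A i x z∈Aj z≢x)))
      ... | no j≢i | _ | inj₁ j∈I₁ = x∈p∪q⁺ (inj₁ (x∈L⁺ _ j∈I₁ (∈-shrink-≢ A i x j≢i z∈Aj)))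
      ... | no j≢i | _ | inj₂ j∈I₂ = x∈p∪q⁺ (inj₂ (x∈L⁺ _ j∈I₂ (∈-shrink-≢ A i y j≢i z∈Aj)))

    LJ⊆U∩V : L A J ⊆ U ∩ V
    LJ⊆U∩V = L-least A λ j∈J z∈Aj →
      let j∈I₁ , j∈I₂ = x∈p∩q⁻ I₁ I₂ (p─q⊆p _ _ j∈J)
          j≢i = x∈p─⁅y⁆⇒x≢y j∈J
      in x∈p∩q⁺ (x∈L⁺ _ j∈I₁ (∈-shrink-≢ A i x j≢i z∈Aj) , x∈L⁺ _ j∈I₂ (∈-shrink-≢ A i y j≢i z∈Aj))

  Hall-shrink : ∀ {x y} → x ≢ y → HallCondition (shrink A i x) ⊎ HallCondition (shrink A i y)
  Hall-shrink {x} {y} x≢y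
    with HallCondition⊎Deficient (shrink A i x) | HallCondition⊎Deficient (shrink A i y)
  ... | inj₁ hallₓ | _ = inj₁ hallₓ
  ... | inj₂ _ | inj₁ hall_y = inj₂ hall_y
  ... | inj₂ (I₁ , d₁) | inj₂ (I₂ , d₂) with i ∈? I₁ | i ∈? I₂
  ...   | no i∉I₁ | _ = contradiction (Hall-shrink-∉ x i∉I₁) (<⇒≱ d₁)
  ...   | yes _ | no i∉I₂ = contradiction (Hall-shrink-∉ y i∉I₂) (<⇒≱ d₂)
  ...   | yes i∈I₁ | yes i∈I₂ = contradiction (begin-strict
    suc (∣ U ∣ ℕ.+ ∣ V ∣)          <⟨ n<1+n _ ⟩
    suc (suc (∣ U ∣ ℕ.+ ∣ V ∣))    ≡⟨ cong suc (sym (+-suc ∣ U ∣ ∣ V ∣)) ⟩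
    suc ∣ U ∣ ℕ.+ suc ∣ V ∣        ≤⟨ +-mono-≤ d₁ d₂ ⟩
    ∣ I₁ ∣ ℕ.+ ∣ I₂ ∣              ≤⟨ shrink-submodular x≢y i∈I₁ i∈I₂ ⟩
    suc (∣ U ∣ ℕ.+ ∣ V ∣)          ∎) (<-irrefl refl)
    where
    U = L (shrink A i x) I₁
    V = L (shrink A i y) I₂

size : (Fin m → Subset n) → ℕ
size {m} A = ∑[ i < m ] ∣ A i ∣

size-shrink : ∀ (A : Fin m → Subset n) i {x} → x ∈ A i → size (shrink A i x) < size A
size-shrink A i x∈Ai =
  ∑-mono-< (λ j → p⊆q⇒∣p∣≤∣q∣ (shrink-⊆ A i _ j)) i (∣shrink∣<∣A∣ A i _ x∈Ai)

Hall⇒SDR : ∀ {A : Fin m → Subset n} → HallCondition A → SDR A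
Hall⇒SDR {m} {n} {A} = go (suc (size A)) A ≤-refl
  where
  go : ∀ k (A : Fin m → Subset n) → size A < k → HallCondition A → SDR A
  go zero _ () _
  go (suc k) A size<k hall with any? (λ i → 2 ≤? ∣ A i ∣)
  ... | no none = Hall⇒SDR-small hall λ i → ≤-pred (≰⇒> (none ∘ (i ,_)))
  ... | yes (i , 2≤∣Ai∣) with 2≤∣p∣⇒distinct (A i) 2≤∣Ai∣
  ... | x , y , x∈Ai , y∈Ai , x≢y with Hall-shrink hall x≢y
  ... | inj₁ hallₓ = SDR-mono (shrink-⊆ A i x)
          (go k (shrink A i x) (<-≤-trans (size-shrink A i x∈Ai) (≤-pred size<k)) hallₓ)
  ... | inj₂ hall_y = SDR-mono (shrink-⊆ A i y)
          (go k (shrink A i y) (<-≤-trans (size-shrink A i y∈Ai) (≤-pred size<k)) hall_y)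

Hall-─ : ∀ (A : Fin m → Subset n) B → (∀ I → Nonempty I → ∣ I ∣ ℕ.+ ∣ B ∣ ≤ ∣ L A I ∣) →
         HallCondition (λ i → A i ─ B)
Hall-─ A B surplus I with nonempty? I
... | no empty = ≤-trans (≮⇒≥ (empty ∘ 0<∣p∣⇒Nonempty I)) z≤n
... | yes ne = +-cancelʳ-≤ ∣ B ∣ _ _ (begin
  ∣ I ∣ ℕ.+ ∣ B ∣             ≤⟨ surplus I ne ⟩
  ∣ L A I ∣                   ≤⟨ p⊆q⇒∣p∣≤∣q∣ L⊆ ⟩
  ∣ L A′ I ∪ B ∣              ≤⟨ ∣p∪q∣≤∣p∣+∣q∣ (L A′ I) B ⟩
  ∣ L A′ I ∣ ℕ.+ ∣ B ∣        ∎)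
  where
  open ≤-Reasoning
  A′ = λ i → A i ─ B
  L⊆ : L A I ⊆ L A′ I ∪ B
  L⊆ = L-least A λ {j} j∈I {z} z∈Aj → case z ∈? B of λ where
    (yes z∈B) → x∈p∪q⁺ (inj₂ z∈B)
    (no z∉B) → x∈p∪q⁺ (inj₁ (x∈L⁺ A′ j∈I (x∈p∧x∉q⇒x∈p─q z∈Aj z∉B)))

length-filter-tabulate : ∀ {a ℓ} {A : Set a} {P : Pred A ℓ} (P? : Decidable P) (f : Fin m → A) →
                         length (filter P? (tabulate f)) ≡ ∑[ i < m ] indicator (P? (f i))
length-filter-tabulate {zero} P? f = refl
length-filter-tabulate {suc m} P? f with P? (f zero)
... | yes _ = cong suc (length-filter-tabulate P? (f ∘ suc))
... | no _ = length-filter-tabulate P? (f ∘ suc)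

∑nτ≡∑∣τ∣ : ∀ (τ : Fin m → Subset n) → ∑[ x < n ] nτ τ x ≡ ∑[ i < m ] ∣ τ i ∣
∑nτ≡∑∣τ∣ {m} {n} τ = begin
  ∑[ x < n ] nτ τ x
    ≡⟨ sum-cong-≗ (λ x → length-filter-tabulate (λ i → x ∈? τ i) id) ⟩
  ∑[ x < n ] ∑[ i < m ] indicator (x ∈? τ i)
    ≡⟨ ∑-comm (λ x i → indicator (x ∈? τ i)) ⟩
  ∑[ i < m ] ∑[ x < n ] indicator (x ∈? τ i)
    ≡⟨ sum-cong-≗ (λ i → sym (∣p∣≡∑ (τ i))) ⟩
  ∑[ i < m ] ∣ τ i ∣
    ∎
  where open ≡-Reasoning

∃-low-degree : ∀ (τ : Fin m → Subset n) {r} → (∀ i → ∣ τ i ∣ ≡ r) → m < n → ∃ λ x → nτ τ x ≤ r ∸ 1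
∃-low-degree {m} {n} τ {r} uniform m<n with any? (λ x → nτ τ x ≤? r ∸ 1)
... | yes low = low
... | no none = contradiction n≤m (<⇒≱ m<n)
  where
  open ≤-Reasoning
  r′ = suc (r ∸ 1)
  n≤m : n ≤ m
  n≤m = *-cancelʳ-≤ n m r′ (begin
    n * r′              ≡⟨ sym (∑-const n r′) ⟩
    ∑[ x < n ] r′       ≤⟨ ∑-mono-≤ (λ x → ≰⇒> (none ∘ (x ,_))) ⟩
    ∑[ x < n ] nτ τ x   ≡⟨ ∑nτ≡∑∣τ∣ τ ⟩
    ∑[ i < m ] ∣ τ i ∣  ≡⟨ sum-cong-≗ uniform ⟩
    ∑[ i < m ] r        ≡⟨ ∑-const m r ⟩
    m * r               ≤⟨ *-monoʳ-≤ m (m≤n+m∸n r 1) ⟩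
    m * r′              ∎)

0≤[a-b]-c⇒b+c≤a : ∀ a b c → + 0 ≤ℤ (+ a - + b) - + c → b ℕ.+ c ≤ a
0≤[a-b]-c⇒b+c≤a a b c 0≤ = drop‿+≤+ (0≤i-j⇒j≤i (subst (+ 0 ≤ℤ_) (sub-sub (+ a) (+ b) (+ c)) 0≤))
  where
  sub-sub : ∀ i j k → (i - j) - k ≡ i - (j + k)
  sub-sub = ℤ-Ring.solve-∀

m+r-1≤n⇒m≤n-r+1 : ∀ {m n r} → 0 < r → m ℕ.+ (r ∸ 1) ≤ n → + m ≤ℤ (+ n - + r) + + 1
m+r-1≤n⇒m≤n-r+1 {m} {n} {suc r} _ m+r≤n =
  subst (+ m ≤ℤ_) (sym n-[1+r]+1≡n∸r) (+≤+ (m+n≤o⇒m≤o∸n m m+r≤n))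
  where
  sub-suc : ∀ i j → (i - (+ 1 + j)) + + 1 ≡ i - j
  sub-suc = ℤ-Ring.solve-∀
  n-[1+r]+1≡n∸r : (+ n - + suc r) + + 1 ≡ + (n ∸ r)
  n-[1+r]+1≡n∸r = trans (sub-suc (+ n) (+ r)) (trans (m-n≡m⊖n n r) (⊖-≥ (m+n≤o⇒n≤o m m+r≤n)))

thin⇒surplus : ∀ (τ : Fin m → Subset n) r I → + 0 ≤ℤ exc r τ I → ∣ I ∣ ℕ.+ (r ∸ 1) ≤ ∣ L τ I ∣
thin⇒surplus τ r I = 0≤[a-b]-c⇒b+c≤a ∣ L τ I ∣ ∣ I ∣ (r ∸ 1)

lemma1 : (n r m : ℕ) → 2 ≤ r → 1 ≤ m
    → (τ : Fin m → Subset n)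
    → Injective _≡_ _≡_ τ
    → (∀ i → ∣ τ i ∣ ≡ r)
    → L τ ⊤ ≡ ⊤
    → (∀ (I : Subset m) → Nonempty I → + 0 ≤ℤ exc r τ I)
    → ((+ m ≤ℤ (+ n - + r) + + 1)
       × (∃ λ (x : Fin n) → nτ τ x ≤ r ∸ 1)
       × (∀ (B : Subset n) → ∣ B ∣ ≡ r ∸ 1
            → Σ (Fin m → Fin n) λ f → Injective _≡_ _≡_ f × (∀ i → f i ∈ (τ i ─ B))))
lemma1 n r m 2≤r 1≤m τ _ uniform covers thin =
  m+r-1≤n⇒m≤n-r+1 (≤-trans (s≤s z≤n) 2≤r) m+r-1≤n ,
  ∃-low-degree τ uniform (<-≤-trans (m<m+n m (∸-monoˡ-≤ 1 2≤r)) m+r-1≤n) ,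
  λ B ∣B∣≡r-1 → Hall⇒SDR (Hall-─ τ B λ I ne →
    subst (λ k → ∣ I ∣ ℕ.+ k ≤ ∣ L τ I ∣) (sym ∣B∣≡r-1) (surplus I ne))
  where
  surplus : ∀ I → Nonempty I → ∣ I ∣ ℕ.+ (r ∸ 1) ≤ ∣ L τ I ∣
  surplus I ne = thin⇒surplus τ r I (thin I ne)

  m+r-1≤n : m ℕ.+ (r ∸ 1) ≤ n
  m+r-1≤n = subst₂ (λ a b → a ℕ.+ (r ∸ 1) ≤ b) (∣⊤∣≡n m) (trans (cong ∣_∣ covers) (∣⊤∣≡n n))
    (surplus ⊤ (0<∣p∣⇒Nonempty ⊤ (subst (0 <_) (sym (∣⊤∣≡n m)) 1≤m)))
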